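{- Let $A$ be an srl-monoid. Then the lattice $\mathrm{Con}(A)$ of congruences of $A$ is order isomorphic (under inclusion) to the set of strongly convex subalgebras of $A$ ordered by inclusion. The isomorphism is given by $\theta\mapsto e/\theta$, with inverse $H\mapsto \theta_H$, where $\theta_H=\{(a,b)\in A\times A: a\cdot h\leq b \text{ and } b\cdot h\leq a \text{ for some } h\in H\}$.
   Context: A commutative l-monoid is an algebra $(A,\wedge,\vee,\cdot,e)$ of type $(2,2,2,0)$ such that $(A,\wedge,\vee)$ is a lattice, $(A,\cdot,e)$ is a commutative monoid and $(a\vee b)\cdot c=(a\cdot c)\vee(b\cdot c)$ for all $a,b,c\in A$. An algebra $(A,\wedge,\vee,\cdot,\rightarrow,e)$ of type $(2,2,2,2,0)$ is an srl-monoid if $(A,\wedge,\vee,\cdot,e)$ is a commutative l-monoid and there is a subalgebra $Q$ of $(A,\wedge,\vee,\cdot,e)$ such that for all $a,b\in A$ the set $\{q\in Q: a\cdot q\leq b\}$ has a maximum and $a\rightarrow b$ equals this maximum. A convex subalgebra of $A$ is a subalgebra $H$ of $(A,\wedge,\vee,\cdot,\rightarrow,e)$ such that whenever $a,b\in H$, $c\in A$ and $a\le c\le b$, then $c\in H$. A strongly convex subalgebra is a convex subalgebra $H$ such that for every $a\in A$ and $h\in H$ with $a\cdot h\leq e\leq h\rightarrow a$ one has $a\in H$. $e/\theta$ denotes the $\theta$-class of $e$. -}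

module Defs where

open import Level using (Level; _⊔_; suc)
open import Data.Product using (Σ; _×_; _,_)
open import Relation.Binary.PropositionalEquality using (_≡_)
open import Relation.Binary.Core using (Rel)
open import Relation.Binary.Structures using (IsEquivalence)
open import Relation.Unary using (Pred; _∈_)
import Algebra.Lattice.Structures as LS
open import Algebra.Structures using (IsCommutativeMonoid)

-- The subalgebra Q witnessing the srl condition is part of the data
-- (equivalent to "there exists such a Q", since the theorem quantifies over all
-- srl-monoids).
record SrlMonoid (ℓ : Level) : Set (suc ℓ) where
  infixr 7 _∙_
  infixr 6 _∧_
  infixr 5 _∨_
  infixr 4 _⇒_
  infix  3 _≤_
  field
    Carrier : Set ℓ
    _∧_ _∨_ _∙_ _⇒_ : Carrier → Carrier → Carrier
    e : Carrier
    -- (A, ∧, ∨) is a lattice (IsLattice takes join first, then meet)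
    isLattice : LS.IsLattice {A = Carrier} _≡_ _∨_ _∧_
    isCommutativeMonoid : IsCommutativeMonoid _≡_ _∙_ e
    distrib : ∀ a b c → (a ∨ b) ∙ c ≡ (a ∙ c) ∨ (b ∙ c)

  _≤_ : Carrier → Carrier → Set ℓ
  a ≤ b = a ∧ b ≡ a

  field
    Q : Pred Carrier ℓ
    Q-∧ : ∀ {a b} → a ∈ Q → b ∈ Q → (a ∧ b) ∈ Q
    Q-∨ : ∀ {a b} → a ∈ Q → b ∈ Q → (a ∨ b) ∈ Q
    Q-∙ : ∀ {a b} → a ∈ Q → b ∈ Q → (a ∙ b) ∈ Q
    Q-e : e ∈ Q
    ⇒-Q   : ∀ a b → (a ⇒ b) ∈ Q
    ⇒-sat : ∀ a b → a ∙ (a ⇒ b) ≤ b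
    ⇒-max : ∀ a b q → q ∈ Q → a ∙ q ≤ b → q ≤ a ⇒ b

module _ {ℓ : Level} (A : SrlMonoid ℓ) where
  open SrlMonoid A

  record IsCongruence (θ : Rel Carrier ℓ) : Set ℓ where
    field
      isEquivalence : IsEquivalence θ
      ∧-compat : ∀ {a b c d} → θ a b → θ c d → θ (a ∧ c) (b ∧ d)
      ∨-compat : ∀ {a b c d} → θ a b → θ c d → θ (a ∨ c) (b ∨ d)
      ∙-compat : ∀ {a b c d} → θ a b → θ c d → θ (a ∙ c) (b ∙ d)
      ⇒-compat : ∀ {a b c d} → θ a b → θ c d → θ (a ⇒ c) (b ⇒ d)

  record IsSubalgebra (H : Pred Carrier ℓ) : Set ℓ where
    field
      ∧-closed : ∀ {a b} → a ∈ H → b ∈ H → (a ∧ b) ∈ H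
      ∨-closed : ∀ {a b} → a ∈ H → b ∈ H → (a ∨ b) ∈ H
      ∙-closed : ∀ {a b} → a ∈ H → b ∈ H → (a ∙ b) ∈ H
      ⇒-closed : ∀ {a b} → a ∈ H → b ∈ H → (a ⇒ b) ∈ H
      e-closed : e ∈ H

  record IsConvexSubalgebra (H : Pred Carrier ℓ) : Set ℓ where
    field
      isSubalgebra : IsSubalgebra H
      convex : ∀ {a b c} → a ∈ H → b ∈ H → a ≤ c → c ≤ b → c ∈ H

  record IsStronglyConvexSubalgebra (H : Pred Carrier ℓ) : Set ℓ where
    field
      isConvexSubalgebra : IsConvexSubalgebra H
      strong : ∀ {a h} → h ∈ H → a ∙ h ≤ e → e ≤ h ⇒ a → a ∈ H

  eClass : Rel Carrier ℓ → Pred Carrier ℓ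
  eClass θ a = θ e a

  θ[_] : Pred Carrier ℓ → Rel Carrier ℓ
  θ[ H ] a b = Σ Carrier λ h → h ∈ H × (a ∙ h ≤ b) × (b ∙ h ≤ a)

  _⊆₂_ : Rel Carrier ℓ → Rel Carrier ℓ → Set ℓ
  θ ⊆₂ φ = ∀ {a b} → θ a b → φ a b

  _≐₂_ : Rel Carrier ℓ → Rel Carrier ℓ → Set ℓ
  θ ≐₂ φ = (θ ⊆₂ φ) × (φ ⊆₂ θ)

{-# OPTIONS --safe #-}
module Submission where

-- Say that h scales a below b when a · h ≤ b. Every operation of A preserves
-- such inequalities once the witnesses are combined suitably (h ∧ k for the
-- lattice operations, h · k for ·, the Q-interiors (e → h) · (e → k) for →), so
-- θ_H is a congruence for every subalgebra H. Conversely, if a θ b then the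
-- witness (a → b) ∧ (b → a) ∧ e is θ-related to (a → a) ∧ (a → a) ∧ e = e, so θ
-- is recovered from e/θ. Strong convexity is exactly what gives e/θ_H ⊆ H: from
-- e · h ≤ a residuation yields e ≤ h → a.

open import Defs
open import Level using (Level)
open import Data.Product using (_×_; _,_)
open import Relation.Binary.Core using (Rel)
open import Relation.Unary using (Pred; _⊆_; _≐_; _∈_)
open import Function.Bundles using (_⇔_; mk⇔)
open import Relation.Binary.PropositionalEquality
  using (_≡_; sym; trans; cong; subst; subst₂)
open import Relation.Binary.Structures using (IsEquivalence)
open import Algebra.Bundles using (CommutativeMonoid)
open import Algebra.Structures using (IsCommutativeMonoid)
open import Algebra.Lattice.Bundles using (Lattice)
import Algebra.Lattice.Properties.Lattice as LatticeProperties
import Algebra.Lattice.Structures as LS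
import Algebra.Properties.CommutativeSemigroup as CommutativeSemigroupProperties
import Relation.Binary.Lattice.Structures as OrderLattice

module SrlMonoidProperties {ℓ : Level} (A : SrlMonoid ℓ) where
  open SrlMonoid A
  open LS.IsLattice isLattice using (∨-comm; ∧-comm; ∧-absorbs-∨)
  open IsCommutativeMonoid isCommutativeMonoid using (assoc; identityˡ; identityʳ; comm)

  private
    lattice : Lattice ℓ ℓ
    lattice = record { isLattice = isLattice }

    commutativeMonoid : CommutativeMonoid ℓ ℓ
    commutativeMonoid = record { isCommutativeMonoid = isCommutativeMonoid }

  open LatticeProperties lattice using (∧-idem; ∨-idem)
  open CommutativeSemigroupProperties (CommutativeMonoid.commutativeSemigroup commutativeMonoid)
    using (interchange; x∙yz≈yx∙z)

  -- The library's natural order of a lattice is x ≡ x ∧ y, the mirror image of _≤_.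
  private
    module N = OrderLattice.IsLattice (LatticeProperties.∨-∧-isOrderTheoreticLattice lattice)

  ≤-refl : ∀ {x} → x ≤ x
  ≤-refl = sym N.refl

  ≤-trans : ∀ {x y z} → x ≤ y → y ≤ z → x ≤ z
  ≤-trans p q = sym (N.trans (sym p) (sym q))

  ≤-antisym : ∀ {x y} → x ≤ y → y ≤ x → x ≡ y
  ≤-antisym p q = N.antisym (sym p) (sym q)

  x∧y≤x : ∀ x y → x ∧ y ≤ x
  x∧y≤x x y = sym (N.x∧y≤x x y)

  x∧y≤y : ∀ x y → x ∧ y ≤ y
  x∧y≤y x y = sym (N.x∧y≤y x y)

  ∧-greatest : ∀ {x y z} → x ≤ y → x ≤ z → x ≤ y ∧ z
  ∧-greatest p q = sym (N.∧-greatest (sym p) (sym q))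

  x≤x∨y : ∀ x y → x ≤ x ∨ y
  x≤x∨y x y = sym (N.x≤x∨y x y)

  y≤x∨y : ∀ x y → y ≤ x ∨ y
  y≤x∨y x y = sym (N.y≤x∨y x y)

  ∨-least : ∀ {x y z} → x ≤ z → y ≤ z → x ∨ y ≤ z
  ∨-least p q = sym (N.∨-least (sym p) (sym q))

  ≤⇒∨≡ : ∀ {x y} → x ≤ y → x ∨ y ≡ y
  ≤⇒∨≡ {x} {y} p = ≤-antisym (∨-least p ≤-refl) (y≤x∨y x y)

  ∨≡⇒≤ : ∀ {x y} → x ∨ y ≡ y → x ≤ y
  ∨≡⇒≤ {x} {y} eq = subst (x ≤_) eq (x≤x∨y x y)

  ∙-monoˡ-≤ : ∀ {x y} z → x ≤ y → x ∙ z ≤ y ∙ z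
  ∙-monoˡ-≤ {x} {y} z p = ∨≡⇒≤ (trans (sym (distrib x y z)) (cong (_∙ z) (≤⇒∨≡ p)))

  ∙-mono-≤ : ∀ {x y u v} → x ≤ y → u ≤ v → x ∙ u ≤ y ∙ v
  ∙-mono-≤ {x} {y} {u} {v} p q =
    ≤-trans (∙-monoˡ-≤ u p) (subst₂ _≤_ (comm u y) (comm v y) (∙-monoˡ-≤ y q))

  ≤⇒e≤⇒ : ∀ {a b} → a ≤ b → e ≤ a ⇒ b
  ≤⇒e≤⇒ {a} {b} p = ⇒-max a b e Q-e (subst (_≤ b) (sym (identityʳ a)) p)

  e⇒x≤x : ∀ x → e ⇒ x ≤ x
  e⇒x≤x x = subst (_≤ x) (identityˡ (e ⇒ x)) (⇒-sat e x)

  e⇒e≡e : (e ⇒ e) ≡ e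
  e⇒e≡e = ≤-antisym (e⇒x≤x e) (≤⇒e≤⇒ ≤-refl)

  scale-antitone : ∀ {a b h k} → k ≤ h → a ∙ h ≤ b → a ∙ k ≤ b
  scale-antitone {a} k≤h p = ≤-trans (∙-mono-≤ (≤-refl {a}) k≤h) p

  scale-trans : ∀ {a b c h k} → a ∙ h ≤ b → b ∙ k ≤ c → a ∙ (h ∙ k) ≤ c
  scale-trans {a} {c = c} {h} {k} p q =
    subst (_≤ c) (assoc a h k) (≤-trans (∙-monoˡ-≤ k p) q)

  scale-∧ : ∀ {a b c d h k} → a ∙ h ≤ b → c ∙ k ≤ d → (a ∧ c) ∙ (h ∧ k) ≤ b ∧ d
  scale-∧ {a} {c = c} {h = h} {k} p q = ∧-greatest
    (≤-trans (∙-mono-≤ (x∧y≤x a c) (x∧y≤x h k)) p)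
    (≤-trans (∙-mono-≤ (x∧y≤y a c) (x∧y≤y h k)) q)

  scale-∨ : ∀ {a b c d h k} → a ∙ h ≤ b → c ∙ k ≤ d → (a ∨ c) ∙ (h ∧ k) ≤ b ∨ d
  scale-∨ {a} {b} {c} {d} {h} {k} p q = subst (_≤ b ∨ d) (sym (distrib a c (h ∧ k))) (∨-least
    (≤-trans (scale-antitone (x∧y≤x h k) p) (x≤x∨y b d))
    (≤-trans (scale-antitone (x∧y≤y h k) q) (y≤x∨y b d)))

  scale-∙ : ∀ {a b c d h k} → a ∙ h ≤ b → c ∙ k ≤ d → (a ∙ c) ∙ (h ∙ k) ≤ b ∙ d
  scale-∙ {a} {b} {c} {d} {h} {k} p q = subst (_≤ b ∙ d) (interchange a h c k) (∙-mono-≤ p q)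

  -- The antitone variable of → is handled by the witness in the opposite direction,
  -- and e → h, e → k replace h, k because the witness must lie in Q.
  scale-⇒ : ∀ {a b c d h k} → b ∙ h ≤ a → c ∙ k ≤ d →
            (a ⇒ c) ∙ ((e ⇒ h) ∙ (e ⇒ k)) ≤ b ⇒ d
  scale-⇒ {a} {b} {c} {d} {h} {k} p q = ⇒-max b d _
    (Q-∙ (⇒-Q a c) (Q-∙ (⇒-Q e h) (⇒-Q e k)))
    (scale-antitone shrink (scale-trans (scale-trans p (⇒-sat a c)) q))
    where
    shrink : (a ⇒ c) ∙ ((e ⇒ h) ∙ (e ⇒ k)) ≤ (h ∙ (a ⇒ c)) ∙ k
    shrink = subst (_≤ (h ∙ (a ⇒ c)) ∙ k) (sym (x∙yz≈yx∙z (a ⇒ c) (e ⇒ h) (e ⇒ k)))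
      (∙-mono-≤ (∙-monoˡ-≤ (a ⇒ c) (e⇒x≤x h)) (e⇒x≤x k))

  biresidual : Carrier → Carrier → Carrier
  biresidual a b = (a ⇒ b) ∧ (b ⇒ a) ∧ e

  biresidual-scaleˡ : ∀ a b → a ∙ biresidual a b ≤ b
  biresidual-scaleˡ a b = scale-antitone (x∧y≤x (a ⇒ b) _) (⇒-sat a b)

  biresidual-scaleʳ : ∀ a b → b ∙ biresidual a b ≤ a
  biresidual-scaleʳ a b =
    scale-antitone (≤-trans (x∧y≤y (a ⇒ b) _) (x∧y≤x (b ⇒ a) e)) (⇒-sat b a)

  biresidual-diag : ∀ a → biresidual a a ≡ e
  biresidual-diag a = trans (cong ((a ⇒ a) ∧_) e-absorbs) e-absorbs
    where
    e-absorbs : (a ⇒ a) ∧ e ≡ e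
    e-absorbs = trans (∧-comm (a ⇒ a) e) (≤⇒e≤⇒ ≤-refl)

  θ[]-monotone : ∀ {H K} → H ⊆ K → _⊆₂_ A (θ[_] A H) (θ[_] A K)
  θ[]-monotone H⊆K (h , h∈H , p , q) = h , H⊆K h∈H , p , q

  θ[]-biresidual : ∀ {H a b} → biresidual a b ∈ H → θ[_] A H a b
  θ[]-biresidual {a = a} {b} r∈H = _ , r∈H , biresidual-scaleˡ a b , biresidual-scaleʳ a b

  module SubalgebraProperties {H : Pred Carrier ℓ} (S : IsSubalgebra A H) where
    open IsSubalgebra S

    biresidual-closed : ∀ {a b} → a ∈ H → b ∈ H → biresidual a b ∈ H
    biresidual-closed a∈H b∈H =
      ∧-closed (⇒-closed a∈H b∈H) (∧-closed (⇒-closed b∈H a∈H) e-closed)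

    θ[]-compat : ∀ {_○_ : Carrier → Carrier → Carrier} (w : Carrier → Carrier → Carrier) →
      (∀ {h k} → h ∈ H → k ∈ H → w h k ∈ H) →
      (∀ {a b c d h k} → a ∙ h ≤ b → b ∙ h ≤ a → c ∙ k ≤ d → d ∙ k ≤ c →
         (a ○ c) ∙ w h k ≤ b ○ d) →
      ∀ {a b c d} → θ[_] A H a b → θ[_] A H c d → θ[_] A H (a ○ c) (b ○ d)
    θ[]-compat w w-closed scale (h , h∈H , p , q) (k , k∈H , p′ , q′) =
      w h k , w-closed h∈H k∈H , scale p q p′ q′ , scale q p q′ p′

    θ[]-isCongruence : IsCongruence A (θ[_] A H)
    θ[]-isCongruence = record
      { isEquivalence = record
        { refl  = θ[]-biresidual (subst (_∈ H) (sym (biresidual-diag _)) e-closed)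
        ; sym   = λ { (h , h∈H , p , q) → h , h∈H , q , p }
        ; trans = λ { (h , h∈H , p , q) (k , k∈H , p′ , q′) →
                      h ∙ k , ∙-closed h∈H k∈H , scale-trans p p′ ,
                      subst (_≤ _) (cong (_ ∙_) (comm k h)) (scale-trans q′ q) } }
      ; ∧-compat = θ[]-compat _∧_ ∧-closed (λ p _ q _ → scale-∧ p q)
      ; ∨-compat = θ[]-compat _∧_ ∧-closed (λ p _ q _ → scale-∨ p q)
      ; ∙-compat = θ[]-compat _∙_ ∙-closed (λ p _ q _ → scale-∙ p q)
      ; ⇒-compat = θ[]-compat (λ h k → (e ⇒ h) ∙ (e ⇒ k))
          (λ h∈H k∈H → ∙-closed (⇒-closed e-closed h∈H) (⇒-closed e-closed k∈H))
          (λ _ q p _ → scale-⇒ q p)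
      }

    ⊆eClass-θ[] : H ⊆ eClass A (θ[_] A H)
    ⊆eClass-θ[] a∈H = θ[]-biresidual (biresidual-closed e-closed a∈H)

  module CongruenceProperties {θ : Rel Carrier ℓ} (C : IsCongruence A θ) where
    open IsCongruence C
    open IsEquivalence isEquivalence renaming (refl to θ-refl; sym to θ-sym; trans to θ-trans)

    class-closed : ∀ {_○_ : Carrier → Carrier → Carrier} →
      (∀ {a b c d} → θ a b → θ c d → θ (a ○ c) (b ○ d)) →
      ∀ {x a b} → x ○ x ≡ x → θ x a → θ x b → θ x (a ○ b)
    class-closed compat idem p q = subst (λ z → θ z _) idem (compat p q)

    class-convex : ∀ {x a b c} → θ x a → θ x b → a ≤ c → c ≤ b → θ x c
    class-convex {x} {a} {b} {c} xa xb a≤c c≤b = θ-sym (subst₂ θ c-form (∧-absorbs-∨ x c)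
      (∧-compat (θ-sym xb) (∨-compat (θ-sym xa) θ-refl)))
      where
      c-form : b ∧ (a ∨ c) ≡ c
      c-form = trans (cong (b ∧_) (≤⇒∨≡ a≤c)) (trans (∧-comm b c) c≤b)

    θ-∙-eClass : ∀ {a h} → θ e h → θ a (a ∙ h)
    θ-∙-eClass {a} {h} eh = subst (λ z → θ z (a ∙ h)) (identityʳ a) (∙-compat θ-refl eh)

    θ-from-∨-∧ : ∀ {x y} → θ (x ∨ y) y → θ (x ∧ y) y → θ x y
    θ-from-∨-∧ {x} {y} join meet =
      θ-trans (subst (λ z → θ z (x ∧ y)) (∧-absorbs-∨ x y) (∧-compat θ-refl join)) meet

    -- a ∨ e θ a · h ∨ e = e, and a ∧ e lies between e ∧ (e → a) θ e ∧ (h → a) = e and e.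
    eClass-strong : ∀ {a h} → θ e h → a ∙ h ≤ e → e ≤ h ⇒ a → θ e a
    eClass-strong {a} {h} eh ah≤e e≤h⇒a = θ-sym (θ-from-∨-∧ join meet)
      where
      join : θ (a ∨ e) e
      join = subst (θ (a ∨ e)) (≤⇒∨≡ ah≤e) (∨-compat (θ-∙-eClass eh) θ-refl)
      e∧e⇒a∈e/θ : θ e (e ∧ (e ⇒ a))
      e∧e⇒a∈e/θ = subst (λ z → θ z (e ∧ (e ⇒ a))) e≤h⇒a
        (∧-compat θ-refl (⇒-compat (θ-sym eh) θ-refl))
      meet : θ (a ∧ e) e
      meet = θ-sym (class-convex e∧e⇒a∈e/θ θ-refl
        (∧-greatest (≤-trans (x∧y≤y e (e ⇒ a)) (e⇒x≤x a)) (x∧y≤x e (e ⇒ a)))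
        (x∧y≤y a e))

    eClass-isStronglyConvexSubalgebra : IsStronglyConvexSubalgebra A (eClass A θ)
    eClass-isStronglyConvexSubalgebra = record
      { isConvexSubalgebra = record
        { isSubalgebra = record
          { ∧-closed = class-closed ∧-compat (∧-idem e)
          ; ∨-closed = class-closed ∨-compat (∨-idem e)
          ; ∙-closed = class-closed ∙-compat (identityˡ e)
          ; ⇒-closed = class-closed ⇒-compat e⇒e≡e
          ; e-closed = θ-refl
          }
        ; convex = class-convex
        }
      ; strong = eClass-strong
      }

    θ[eClass]⊆θ : _⊆₂_ A (θ[_] A (eClass A θ)) θ
    θ[eClass]⊆θ {a} {b} (h , eh , p , q) =
      θ-trans (θ-∨-absorb q) (θ-sym (subst (θ b) (∨-comm b a) (θ-∨-absorb p)))
      where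
      θ-∨-absorb : ∀ {x y} → y ∙ h ≤ x → θ x (x ∨ y)
      θ-∨-absorb {x} {y} yh≤x = subst (λ z → θ z (x ∨ y)) (trans (∨-comm x (y ∙ h)) (≤⇒∨≡ yh≤x))
        (∨-compat θ-refl (θ-sym (θ-∙-eClass eh)))

    θ⊆θ[eClass] : _⊆₂_ A θ (θ[_] A (eClass A θ))
    θ⊆θ[eClass] {a} {b} ab = θ[]-biresidual
      (subst (λ z → θ z (biresidual a b)) (biresidual-diag a)
        (∧-compat (⇒-compat θ-refl ab) (∧-compat (⇒-compat ab θ-refl) θ-refl)))

  open SubalgebraProperties public
  open CongruenceProperties public

  eClass-θ[]⊆ : ∀ {H} → IsStronglyConvexSubalgebra A H → eClass A (θ[_] A H) ⊆ H
  eClass-θ[]⊆ S {a} (h , h∈H , eh≤a , ah≤e) =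
    IsStronglyConvexSubalgebra.strong S h∈H ah≤e
      (⇒-max h a e Q-e (subst (_≤ a) (comm e h) eh≤a))

  ⊆₂⇔eClass⊆ : ∀ {θ φ} → IsCongruence A θ → IsCongruence A φ →
               _⊆₂_ A θ φ ⇔ (eClass A θ ⊆ eClass A φ)
  ⊆₂⇔eClass⊆ {θ} {φ} Cθ Cφ = mk⇔ ⊆₂⇒eClass⊆ eClass⊆⇒⊆₂
    where
    ⊆₂⇒eClass⊆ : _⊆₂_ A θ φ → eClass A θ ⊆ eClass A φ
    ⊆₂⇒eClass⊆ θ⊆φ = θ⊆φ
    eClass⊆⇒⊆₂ : eClass A θ ⊆ eClass A φ → _⊆₂_ A θ φ
    eClass⊆⇒⊆₂ e/θ⊆e/φ ab = θ[eClass]⊆θ Cφ (θ[]-monotone e/θ⊆e/φ (θ⊆θ[eClass] Cθ ab))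

  isSubalgebra : ∀ {H} → IsStronglyConvexSubalgebra A H → IsSubalgebra A H
  isSubalgebra S =
    IsConvexSubalgebra.isSubalgebra (IsStronglyConvexSubalgebra.isConvexSubalgebra S)

theorem3p7 : ∀ {ℓ} (A : SrlMonoid ℓ) →
    let open SrlMonoid A in
    -- θ ↦ e/θ maps congruences to strongly convex subalgebras
    (∀ (θ : Rel Carrier ℓ) → IsCongruence A θ → IsStronglyConvexSubalgebra A (eClass A θ))
    -- H ↦ θ_H maps strongly convex subalgebras to congruences
    × (∀ (H : Pred Carrier ℓ) → IsStronglyConvexSubalgebra A H → IsCongruence A (θ[_] A H))
    -- the two maps are mutually inverse
    × (∀ (θ : Rel Carrier ℓ) → IsCongruence A θ → _≐₂_ A (θ[_] A (eClass A θ)) θ)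
    × (∀ (H : Pred Carrier ℓ) → IsStronglyConvexSubalgebra A H → eClass A (θ[_] A H) ≐ H)
    -- θ ↦ e/θ is an order embedding w.r.t. inclusion (hence, being bijective, an order isomorphism)
    × (∀ (θ φ : Rel Carrier ℓ) → IsCongruence A θ → IsCongruence A φ →
         (_⊆₂_ A θ φ ⇔ (eClass A θ ⊆ eClass A φ)))
theorem3p7 A =
    (λ _ → eClass-isStronglyConvexSubalgebra)
  , (λ _ S → θ[]-isCongruence (isSubalgebra S))
  , (λ _ C → θ[eClass]⊆θ C , θ⊆θ[eClass] C)
  , (λ _ S → eClass-θ[]⊆ S , ⊆eClass-θ[] (isSubalgebra S))
  , (λ _ _ → ⊆₂⇔eClass⊆)
  where open SrlMonoidProperties A
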